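{- Let $\alpha$ be a cascading $n$-sequence and $l\in[n]$, and suppose that $\alpha$ satisfies the Lyndon property for every letter $l'\le l$. If $I$ is a lower subinterval of $\alpha$ with head $j\le l$, then all entries of $I$ not exceeding $l$ have the same lane number, and for every entry $l'$ of $I$ with $j\le l'\le l$, the lane depth of that entry is $l'-j+1$.
   Context: An $m$-lower subinterval ($1\le a\le m\le n$) is the tuple $(a,a+1,\ldots,m)$; its head is $a$ and its right endpoint is $m$. An $m$-component is a finite (possibly empty) sequence of $m$-lower subintervals ordered by nonincreasing length; a cascading $n$-sequence is the concatenation of an $n$-component, an $(n-1)$-component, $\ldots$, a $1$-component, regarded both as its list of lower subintervals $I_1,\ldots,I_P$ (left to right) and as the concatenated integer sequence. For $i\le P$, $\alpha[i]$ denotes the cascading sequence consisting of $I_1,\ldots,I_i$. $\alpha$ satisfies the Lyndon property for the letter $l'$ if for every $i$ and every $j<l'$, $\alpha[i]$ contains at least as many lower subintervals with head $l'$ as lower subintervals with head $j$. Lanes: the entries of $\alpha$ are distributed into lanes $L_d(v)$ ($v\in[n]$, $d\ge1$), tuples of entries of value $v$, by processing $I_1,\ldots,I_P$ in order, all lanes initially empty; to process $I_b=(v_1,\ldots,v_s)$: let $d_1$ be the largest $d\ge1$ with $L_d(v_1)$ currently nonempty ($0$ if none) and append the entry $v_1$ of $I_b$ to $L_{d_1+1}(v_1)$; for $k=2,\ldots,s$ in order let $d_k$ be the largest $d$ with $1\le d\le d_{k-1}$ and $|L_d(v_k)|>|L_{d+1}(v_k)|$ (current lengths, $|L|$ the number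 of entries), or $0$ if none, and append the entry $v_k$ of $I_b$ to $L_{d_k+1}(v_k)$. If an entry of $\alpha$ is the $t$-th entry of the lane $L_d(v)$, it has lane number $d$ and lane depth $t$. -}

module Defs where

open import Data.Nat using (ℕ; zero; suc; _≤_; _<_; _⊔_; _∸_)
open import Data.Nat.Properties using (_≟_; _<?_)
open import Data.Bool using (if_then_else_)
open import Data.List using (List; []; _∷_; _++_; [_]; length; filter; take; lookup)
open import Data.Fin using (Fin)
open import Data.Product using (_×_; _,_; proj₁; proj₂)
open import Data.Sum using (_⊎_)
open import Relation.Binary.PropositionalEquality using (_≡_)
open import Relation.Nullary.Decidable using (⌊_⌋; _×-dec_)
open import Data.List.Relation.Unary.All using (All)
open import Data.List.Relation.Unary.Linked using (Linked)

-- A lower subinterval (a, a+1, ..., m) is encoded by the pair (a , m):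
-- proj₁ = head a, proj₂ = right endpoint m.
Interval : Set
Interval = ℕ × ℕ

IsLowerSubinterval : ℕ → Interval → Set
IsLowerSubinterval n (a , m) = (1 ≤ a) × (a ≤ m) × (m ≤ n)

-- Ordering of consecutive lower subintervals in a cascading sequence:
-- the n-component comes first, then the (n-1)-component, ... (right endpoints
-- nonincreasing), and inside a component lengths m-a+1 are nonincreasing,
-- i.e. heads are nondecreasing.
Precedes : Interval → Interval → Set
Precedes (a , m) (a' , m') = (m' < m) ⊎ ((m' ≡ m) × (a ≤ a'))

IsCascading : ℕ → List Interval → Set
IsCascading n α = All (IsLowerSubinterval n) α × Linked Precedes α

headCount : ℕ → List Interval → ℕ
headCount h β = length (filter (λ I → proj₁ I ≟ h) β)

-- Lyndon property for the letter l' (α[i] = take i α)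
LyndonFor : List Interval → ℕ → Set
LyndonFor α l' = ∀ (i j : ℕ) → j < l' → headCount j (take i α) ≤ headCount l' (take i α)

-- Lanes.  The history records, in processing order, every entry already
-- placed, as (value v , lane number d).  |L_d(v)| is the number of
-- entries of the history equal to (v , d).

Hist : Set
Hist = List (ℕ × ℕ)

laneLen : Hist → ℕ → ℕ → ℕ
laneLen h v d = length (filter (λ e → (proj₁ e ≟ v) ×-dec (proj₂ e ≟ d)) h)

maxLane : Hist → ℕ → ℕ
maxLane [] v = 0
maxLane ((w , d) ∷ h) v = if ⌊ w ≟ v ⌋ then d ⊔ maxLane h v else maxLane h v

searchDown : Hist → ℕ → ℕ → ℕ
searchDown h v zero = 0
searchDown h v (suc d) =
  if ⌊ laneLen h v (suc (suc d)) <? laneLen h v (suc d) ⌋ then suc d else searchDown h v d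

-- process entries v, v+1, ... (k of them), d_{prev} the previous d;
-- returns new history and, per entry, (lane number , lane depth)
procRest : Hist → ℕ → ℕ → ℕ → Hist × List (ℕ × ℕ)
procRest h v zero dprev = h , []
procRest h v (suc k) dprev =
  let dk = searchDown h v dprev
      h' = h ++ [ (v , suc dk) ]
      r  = procRest h' (suc v) k dk
  in proj₁ r , ((suc dk , laneLen h' v (suc dk)) ∷ proj₂ r)

procInterval : Hist → Interval → Hist × List (ℕ × ℕ)
procInterval h (a , m) =
  let d1 = maxLane h a
      h' = h ++ [ (a , suc d1) ]
      r  = procRest h' (suc a) (m ∸ a) d1
  in proj₁ r , ((suc d1 , laneLen h' a (suc d1)) ∷ proj₂ r)

laneTableFrom : Hist → List Interval → List (List (ℕ × ℕ))
laneTableFrom h [] = []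
laneTableFrom h (I ∷ α) = let r = procInterval h I in proj₂ r ∷ laneTableFrom (proj₁ r) α

laneTable : List Interval → List (List (ℕ × ℕ))
laneTable α = laneTableFrom [] α

nthD : {A : Set} → A → List A → ℕ → A
nthD d [] _ = d
nthD d (x ∷ xs) zero = x
nthD d (x ∷ xs) (suc i) = nthD d xs i

-- (lane number , lane depth) of the entry with value v of the b-th
-- lower subinterval of α (meaningful for head ≤ v ≤ right endpoint)
entryInfo : (α : List Interval) → Fin (length α) → ℕ → ℕ × ℕ
entryInfo α b v =
  nthD (0 , 0) (nthD [] (laneTable α) (Data.Fin.toℕ b)) (v ∸ proj₁ (lookup α b))

laneNumber : (α : List Interval) → Fin (length α) → ℕ → ℕ
laneNumber α b v = proj₁ (entryInfo α b v)

laneDepth : (α : List Interval) → Fin (length α) → ℕ → ℕ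
laneDepth α b v = proj₂ (entryInfo α b v)

-- Along α one maintains the invariant that for every value w ≤ l and every d the lane
-- L_{d+1}(w) has as many entries as there are heads j' ≤ w of which more than d of the
-- intervals processed so far contain w.  When an interval (j , m) with j ≤ l comes, every
-- earlier interval ends at or after m, since right endpoints never increase.  So for
-- j ≤ w ≤ m exactly c = #{earlier heads j} intervals with head j contain w, at most c with
-- any smaller head do (Lyndon property for j), and more than c with any head j' ∈ (j , l]
-- do (Lyndon property for j', counting the new interval).  Hence L_{c+1}(w) has w − j
-- entries and L_c(w) has more: the head entry starts the empty lane L_{c+1}(j), and the
-- lane search of every later entry w ≤ l stops at once at c + 1, giving depth w − j + 1.
-- Each such L_{c+1}(w) gains one entry, which is exactly the change in the counts, so the
-- invariant persists.

module Submission where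

open import Defs
open import Level using (Level)
open import Data.Nat using (ℕ; zero; suc; _+_; _≤_; _<_; _∸_; z≤n; s≤s; z<s; _≤?_; _<?_)
open import Data.Nat.Properties
open import Algebra.Properties.CommutativeSemigroup +-commutativeSemigroup using (xy∙z≈xz∙y)
open import Data.List using (List; []; _∷_; _++_; [_]; length; filter; take; lookup)
open import Data.List.Properties using (filter-++; length-++; filter-accept; filter-reject; length-filter; ++-assoc; ++-identityʳ)
open import Data.List.Relation.Unary.All as All using (All; []; _∷_)
open import Data.List.Relation.Unary.All.Properties using (++⁺)
open import Data.List.Relation.Unary.AllPairs using (AllPairs; _∷_)
import Data.List.Relation.Unary.Linked as Linked
open import Data.List.Relation.Unary.Linked.Properties using (Linked⇒AllPairs)
open import Data.Fin using (Fin; toℕ) renaming (zero to fzero; suc to fsuc)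
open import Data.Product using (_×_; _,_; proj₁; proj₂; ∃-syntax)
open import Data.Sum using (_⊎_; inj₁; inj₂; [_,_]′)
open import Function using (_∘_)
open import Relation.Nullary using (yes; no; ¬_; contradiction)
open import Relation.Nullary.Decidable using (_×-dec_)
open import Relation.Unary using (Pred; Decidable)
open import Relation.Binary.PropositionalEquality hiding ([_])

module _ {A : Set} {p : Level} {P : Pred A p} (P? : Decidable P) where

  length-filter-++ : ∀ xs ys → length (filter P? (xs ++ ys)) ≡ length (filter P? xs) + length (filter P? ys)
  length-filter-++ xs ys = trans (cong length (filter-++ P? xs ys)) (length-++ (filter P? xs))

  length-filter-accept : ∀ {x} → P x → length (filter P? [ x ]) ≡ 1
  length-filter-accept px = cong length (filter-accept P? px)

  length-filter-reject : ∀ {x} → ¬ P x → length (filter P? [ x ]) ≡ 0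
  length-filter-reject ¬px = cong length (filter-reject P? ¬px)

headCount-++ : ∀ j β β' → headCount j (β ++ β') ≡ headCount j β + headCount j β'
headCount-++ j β β' = length-filter-++ (λ I → proj₁ I ≟ j) β β'

headCount-∷ʳ-self : ∀ j m β → headCount j (β ++ [ (j , m) ]) ≡ suc (headCount j β)
headCount-∷ʳ-self j m β = trans (headCount-++ j β _)
  (trans (cong (headCount j β +_) (length-filter-accept (λ I → proj₁ I ≟ j) refl)) (+-comm _ 1))

headCount-∷ʳ-other : ∀ {a} m β {j} → ¬ a ≡ j → headCount j (β ++ [ (a , m) ]) ≡ headCount j β
headCount-∷ʳ-other m β {j} a≢j = trans (headCount-++ j β _)
  (trans (cong (headCount j β +_) (length-filter-reject (λ I → proj₁ I ≟ j) a≢j)) (+-identityʳ _))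

reaches? : (j w : ℕ) → Decidable (λ (I : Interval) → proj₁ I ≡ j × w ≤ proj₂ I)
reaches? j w I = (proj₁ I ≟ j) ×-dec (w ≤? proj₂ I)

reachCount : ℕ → ℕ → List Interval → ℕ
reachCount j w β = length (filter (reaches? j w) β)

reachCount-∷ʳ-self : ∀ j w {m} β → w ≤ m → reachCount j w (β ++ [ (j , m) ]) ≡ suc (reachCount j w β)
reachCount-∷ʳ-self j w β w≤m = trans (length-filter-++ (reaches? j w) β _)
  (trans (cong (reachCount j w β +_) (length-filter-accept (reaches? j w) (refl , w≤m))) (+-comm _ 1))

reachCount-∷ʳ-other : ∀ {a m} β {j w} → ¬ (a ≡ j × w ≤ m) → reachCount j w (β ++ [ (a , m) ]) ≡ reachCount j w β
reachCount-∷ʳ-other β {j} {w} ne = trans (length-filter-++ (reaches? j w) β _)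
  (trans (cong (reachCount j w β +_) (length-filter-reject (reaches? j w) ne)) (+-identityʳ _))

reachCount≤headCount : ∀ j w β → reachCount j w β ≤ headCount j β
reachCount≤headCount j w []            = z≤n
reachCount≤headCount j w ((a , m) ∷ β) = begin
  reachCount j w ((a , m) ∷ β)                         ≡⟨ length-filter-++ (reaches? j w) [ (a , m) ] β ⟩
  reachCount j w [ (a , m) ] + reachCount j w β         ≤⟨ +-mono-≤ single (reachCount≤headCount j w β) ⟩
  headCount j [ (a , m) ] + headCount j β               ≡⟨ headCount-++ j [ (a , m) ] β ⟨
  headCount j ((a , m) ∷ β)                            ∎
  where
  open ≤-Reasoning
  single : reachCount j w [ (a , m) ] ≤ headCount j [ (a , m) ]
  single with a ≟ j
  ... | yes refl = ≤-trans (length-filter (reaches? j w) [ (a , m) ])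
                     (≤-reflexive (sym (length-filter-accept (λ I → proj₁ I ≟ j) refl)))
  ... | no a≢j   = ≤-trans (≤-reflexive (length-filter-reject (reaches? j w) (a≢j ∘ proj₁))) z≤n

reachCount≡headCount : ∀ j w β → All (λ I → w ≤ proj₂ I) β → reachCount j w β ≡ headCount j β
reachCount≡headCount j w []            []            = refl
reachCount≡headCount j w ((a , m) ∷ β) (w≤m ∷ reach) = begin
  reachCount j w ((a , m) ∷ β)                  ≡⟨ length-filter-++ (reaches? j w) [ (a , m) ] β ⟩
  reachCount j w [ (a , m) ] + reachCount j w β ≡⟨ cong₂ _+_ single (reachCount≡headCount j w β reach) ⟩
  headCount j [ (a , m) ] + headCount j β       ≡⟨ headCount-++ j [ (a , m) ] β ⟨
  headCount j ((a , m) ∷ β)                     ∎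
  where
  open ≡-Reasoning
  single : reachCount j w [ (a , m) ] ≡ headCount j [ (a , m) ]
  single with a ≟ j
  ... | yes refl = trans (length-filter-accept (reaches? j w) (refl , w≤m))
                     (sym (length-filter-accept (λ I → proj₁ I ≟ j) refl))
  ... | no a≢j   = trans (length-filter-reject (reaches? j w) (a≢j ∘ proj₁))
                     (sym (length-filter-reject (λ I → proj₁ I ≟ j) a≢j))

𝟙[_<_] : ℕ → ℕ → ℕ
𝟙[ d     < zero  ] = 0
𝟙[ zero  < suc r ] = 1
𝟙[ suc d < suc r ] = 𝟙[ d < r ]

𝟙[<]-0 : ∀ {d r} → r ≤ d → 𝟙[ d < r ] ≡ 0
𝟙[<]-0 {d}     {zero}  _         = refl
𝟙[<]-0 {suc d} {suc r} (s≤s r≤d) = 𝟙[<]-0 r≤d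

𝟙[<]-1 : ∀ {d r} → d < r → 𝟙[ d < r ] ≡ 1
𝟙[<]-1 {zero}  {suc r} _         = refl
𝟙[<]-1 {suc d} {suc r} (s≤s d<r) = 𝟙[<]-1 d<r

𝟙[<]-suc : ∀ {d c} → ¬ d ≡ c → 𝟙[ d < suc c ] ≡ 𝟙[ d < c ]
𝟙[<]-suc {zero}  {zero}  d≢c = contradiction refl d≢c
𝟙[<]-suc {zero}  {suc c} _   = refl
𝟙[<]-suc {suc d} {zero}  _   = 𝟙[<]-0 {d} z≤n
𝟙[<]-suc {suc d} {suc c} d≢c = 𝟙[<]-suc {d} {c} (d≢c ∘ cong suc)

sumBelow : (ℕ → ℕ) → ℕ → ℕ
sumBelow f zero    = 0
sumBelow f (suc t) = sumBelow f t + f t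

sumBelow-cong : ∀ {f g} t → (∀ i → i < t → f i ≡ g i) → sumBelow f t ≡ sumBelow g t
sumBelow-cong zero    _  = refl
sumBelow-cong (suc t) eq = cong₂ _+_ (sumBelow-cong t (λ i i<t → eq i (m<n⇒m<1+n i<t))) (eq t ≤-refl)

sumBelow-zero : ∀ {f} t → (∀ i → i < t → f i ≡ 0) → sumBelow f t ≡ 0
sumBelow-zero zero    _     = refl
sumBelow-zero (suc t) zeros = cong₂ _+_ (sumBelow-zero t (λ i i<t → zeros i (m<n⇒m<1+n i<t))) (zeros t ≤-refl)

sumBelow-step : ∀ {f} j t → (∀ i → i < t → i ≤ j → f i ≡ 0) → (∀ i → i < t → j < i → f i ≡ 1) →
  sumBelow f t ≡ t ∸ suc j
sumBelow-step j zero    _     _    = refl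
sumBelow-step {f} j (suc t) zeros ones with t ≤? j
... | yes t≤j = begin
  sumBelow f t + f t ≡⟨ cong₂ _+_ IH (zeros t ≤-refl t≤j) ⟩
  t ∸ suc j + 0      ≡⟨ +-identityʳ _ ⟩
  t ∸ suc j          ≡⟨ m≤n⇒m∸n≡0 (m≤n⇒m≤1+n t≤j) ⟩
  0                  ≡⟨ m≤n⇒m∸n≡0 t≤j ⟨
  t ∸ j              ∎
  where
  open ≡-Reasoning
  IH = sumBelow-step j t (λ i i<t → zeros i (m<n⇒m<1+n i<t)) (λ i i<t → ones i (m<n⇒m<1+n i<t))
... | no t≰j = begin
  sumBelow f t + f t ≡⟨ cong₂ _+_ IH (ones t ≤-refl (≰⇒> t≰j)) ⟩
  t ∸ suc j + 1      ≡⟨ +-comm _ 1 ⟩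
  suc (t ∸ suc j)    ≡⟨ +-∸-assoc 1 (≰⇒> t≰j) ⟨
  t ∸ j              ∎
  where
  open ≡-Reasoning
  IH = sumBelow-step j t (λ i i<t → zeros i (m<n⇒m<1+n i<t)) (λ i i<t → ones i (m<n⇒m<1+n i<t))

sumBelow-lower : ∀ {f} j t → (∀ i → j ≤ i → i < t → f i ≡ 1) → t ∸ j ≤ sumBelow f t
sumBelow-lower j zero _ = ≤-reflexive (0∸n≡0 j)
sumBelow-lower {f} j (suc t) ones with j ≤? t
... | yes j≤t = begin
  suc t ∸ j          ≡⟨ +-∸-assoc 1 j≤t ⟩
  suc (t ∸ j)        ≡⟨ +-comm 1 _ ⟩
  t ∸ j + 1          ≤⟨ +-mono-≤ (sumBelow-lower j t (λ i j≤i i<t → ones i j≤i (m<n⇒m<1+n i<t))) (≤-reflexive (sym (ones t j≤t ≤-refl))) ⟩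
  sumBelow f t + f t ∎
  where open ≤-Reasoning
... | no j≰t = ≤-trans (≤-reflexive (m≤n⇒m∸n≡0 (≰⇒> j≰t))) z≤n

sumBelow-update : ∀ {f g} j t → (∀ i → i < t → ¬ i ≡ j → f i ≡ g i) → j < t →
  sumBelow g t + f j ≡ sumBelow f t + g j
sumBelow-update {f} {g} j (suc t) agree j<t with t ≟ j
... | yes refl = begin
  sumBelow g t + g t + f t ≡⟨ xy∙z≈xz∙y (sumBelow g t) (g t) (f t) ⟩
  sumBelow g t + f t + g t ≡⟨ cong (λ s → s + f t + g t) (sumBelow-cong t agreeBelow) ⟨
  sumBelow f t + f t + g t ∎
  where
  open ≡-Reasoning
  agreeBelow : ∀ i → i < t → f i ≡ g i
  agreeBelow i i<t = agree i (m<n⇒m<1+n i<t) (<⇒≢ i<t)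
... | no t≢j = begin
  sumBelow g t + g t + f j ≡⟨ xy∙z≈xz∙y (sumBelow g t) (g t) (f j) ⟩
  sumBelow g t + f j + g t ≡⟨ cong (_+ g t) (sumBelow-update j t (λ i i<t → agree i (m<n⇒m<1+n i<t)) j<t′) ⟩
  sumBelow f t + g j + g t ≡⟨ xy∙z≈xz∙y (sumBelow f t) (g j) (g t) ⟩
  sumBelow f t + g t + g j ≡⟨ cong (λ x → sumBelow f t + x + g j) (agree t ≤-refl t≢j) ⟨
  sumBelow f t + f t + g j ∎
  where
  open ≡-Reasoning
  j<t′ : j < t
  j<t′ = ≤∧≢⇒< (≤-pred j<t) (t≢j ∘ sym)

inLane? : (v d : ℕ) → Decidable (λ (e : ℕ × ℕ) → proj₁ e ≡ v × proj₂ e ≡ d)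
inLane? v d e = (proj₁ e ≟ v) ×-dec (proj₂ e ≟ d)

laneLen-++ : ∀ h h' v d → laneLen (h ++ h') v d ≡ laneLen h v d + laneLen h' v d
laneLen-++ h h' v d = length-filter-++ (inLane? v d) h h'

laneLen-self : ∀ v d → laneLen [ (v , d) ] v d ≡ 1
laneLen-self v d = length-filter-accept (inLane? v d) (refl , refl)

laneLen-other : ∀ {w e v d} → ¬ (w ≡ v × e ≡ d) → laneLen [ (w , e) ] v d ≡ 0
laneLen-other {v = v} {d} ne = length-filter-reject (inLane? v d) ne

laneLen-∷-other : ∀ h {w e v d} → ¬ (w ≡ v × e ≡ d) → laneLen ((w , e) ∷ h) v d ≡ laneLen h v d
laneLen-∷-other h {w} {e} {v} {d} ne = trans (laneLen-++ [ (w , e) ] h v d) (cong (_+ laneLen h v d) (laneLen-other ne))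

laneLen-∷-self : ∀ h v d → laneLen ((v , d) ∷ h) v d ≡ suc (laneLen h v d)
laneLen-∷-self h v d = trans (laneLen-++ [ (v , d) ] h v d) (cong (_+ laneLen h v d) (laneLen-self v d))

laneLen-∷ʳ-self : ∀ h v d → laneLen (h ++ [ (v , d) ]) v d ≡ suc (laneLen h v d)
laneLen-∷ʳ-self h v d = trans (laneLen-++ h _ v d) (trans (cong (laneLen h v d +_) (laneLen-self v d)) (+-comm _ 1))

laneLen-∷ʳ-other : ∀ h {v e w d} → ¬ (v ≡ w × e ≡ d) → laneLen (h ++ [ (v , e) ]) w d ≡ laneLen h w d
laneLen-∷ʳ-other h {v} {e} {w} {d} ne = begin
  laneLen (h ++ [ (v , e) ]) w d          ≡⟨ laneLen-++ h _ w d ⟩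
  laneLen h w d + laneLen [ (v , e) ] w d ≡⟨ cong (laneLen h w d +_) (laneLen-other ne) ⟩
  laneLen h w d + 0                       ≡⟨ +-identityʳ _ ⟩
  laneLen h w d                           ∎
  where open ≡-Reasoning

laneLen-skip : ∀ h {v e} h' {w d} → ¬ v ≡ w → laneLen ((h ++ [ (v , e) ]) ++ h') w d ≡ laneLen (h ++ h') w d
laneLen-skip h {v} {e} h' {w} {d} v≢w = begin
  laneLen ((h ++ [ (v , e) ]) ++ h') w d       ≡⟨ laneLen-++ (h ++ [ (v , e) ]) h' w d ⟩
  laneLen (h ++ [ (v , e) ]) w d + laneLen h' w d ≡⟨ cong (_+ laneLen h' w d) (laneLen-∷ʳ-other h (v≢w ∘ proj₁)) ⟩
  laneLen h w d + laneLen h' w d               ≡⟨ sym (laneLen-++ h h' w d) ⟩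
  laneLen (h ++ h') w d                        ∎
  where open ≡-Reasoning

maxLane-≤ : ∀ h v c → (∀ d → c < d → laneLen h v d ≡ 0) → maxLane h v ≤ c
maxLane-≤ []            v c empty = z≤n
maxLane-≤ ((w , e) ∷ h) v c empty with w ≟ v
... | no w≢v = maxLane-≤ h v c (λ d c<d → trans (sym (laneLen-∷-other h (w≢v ∘ proj₁))) (empty d c<d))
... | yes refl = ⊔-lub e≤c (maxLane-≤ h w c emptyTail)
  where
  emptyTail : ∀ d → c < d → laneLen h w d ≡ 0
  emptyTail d c<d = m+n≡0⇒n≡0 (laneLen [ (w , e) ] w d) (trans (sym (laneLen-++ [ (w , e) ] h w d)) (empty d c<d))
  e≤c : e ≤ c
  e≤c = ≮⇒≥ (λ c<e → 1+n≢0 (trans (sym (laneLen-∷-self h w e)) (empty e c<e)))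

≤-maxLane : ∀ h v d → 0 < laneLen h v d → d ≤ maxLane h v
≤-maxLane []            v d ()
≤-maxLane ((w , e) ∷ h) v d nonempty with w ≟ v
... | no w≢v = ≤-maxLane h v d (subst (0 <_) (laneLen-∷-other h (w≢v ∘ proj₁)) nonempty)
... | yes refl with e ≟ d
...   | yes refl = m≤m⊔n e (maxLane h w)
...   | no e≢d = m≤n⇒m≤o⊔n e (≤-maxLane h w d (subst (0 <_) (laneLen-∷-other h {w} {e} {w} {d} (e≢d ∘ proj₂)) nonempty))

-- Exactly the condition under which searchDown h v c returns c.
Drops : Hist → ℕ → ℕ → Set
Drops h v c = c ≡ 0 ⊎ laneLen h v (suc c) < laneLen h v c

drops-resp : ∀ {h h' v c} → (∀ d → laneLen h v d ≡ laneLen h' v d) → Drops h v c → Drops h' v c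
drops-resp same (inj₁ c≡0) = inj₁ c≡0
drops-resp same (inj₂ shorter) = inj₂ (subst₂ _<_ (same _) (same _) shorter)

searchDown-stops : ∀ h v c → Drops h v c → searchDown h v c ≡ c
searchDown-stops h v zero    _ = refl
searchDown-stops h v (suc c) (inj₂ shorter) with laneLen h v (suc (suc c)) <? laneLen h v (suc c)
... | yes _ = refl
... | no longer = contradiction shorter longer

procRest-unfold : ∀ h v k d {x} → searchDown h v d ≡ x →
  let h' = h ++ [ (v , suc x) ] ; r = procRest h' (suc v) k x
  in procRest h v (suc k) d ≡ (proj₁ r , (suc x , laneLen h' v (suc x)) ∷ proj₂ r)
procRest-unfold h v k d refl = refl

procInterval-unfold : ∀ h j m {x} → maxLane h j ≡ x →
  let h' = h ++ [ (j , suc x) ] ; r = procRest h' (suc j) (m ∸ j) x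
  in procInterval h (j , m) ≡ (proj₁ r , (suc x , laneLen h' j (suc x)) ∷ proj₂ r)
procInterval-unfold h j m refl = refl

outside-suc : ∀ {v k w} → w < v ⊎ v + suc k ≤ w → ¬ v ≡ w × (w < suc v ⊎ suc v + k ≤ w)
outside-suc (inj₁ w<v) = ≢-sym (<⇒≢ w<v) , inj₁ (m<n⇒m<1+n w<v)
outside-suc {v} {k} {w} (inj₂ v+k<w) = <⇒≢ (≤-trans (s≤s (m≤m+n v k)) v+k<w′) , inj₂ v+k<w′
  where
  v+k<w′ : suc v + k ≤ w
  v+k<w′ = subst (_≤ w) (+-suc v k) v+k<w

outside-interval : ∀ {j m w} → j ≤ m → w < j ⊎ m < w → w < j ⊎ j + suc (m ∸ j) ≤ w
outside-interval j≤m (inj₁ w<j) = inj₁ w<j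
outside-interval {j} {m} {w} j≤m (inj₂ m<w) = inj₂ (subst (_≤ w) (sym (trans (+-suc j (m ∸ j)) (cong suc (m+[n∸m]≡n j≤m)))) m<w)

procRest-frame : ∀ h v k d {w d'} → w < v ⊎ v + k ≤ w →
  laneLen (proj₁ (procRest h v k d)) w d' ≡ laneLen h w d'
procRest-frame h v zero    d _ = refl
procRest-frame h v (suc k) d {w} {d'} outside = begin
  laneLen (proj₁ (procRest h' (suc v) k dₖ)) w d' ≡⟨ procRest-frame h' (suc v) k dₖ (proj₂ (outside-suc outside)) ⟩
  laneLen h' w d'                                 ≡⟨ laneLen-∷ʳ-other h (proj₁ (outside-suc outside) ∘ proj₁) ⟩
  laneLen h w d'                                  ∎
  where
  open ≡-Reasoning
  dₖ = searchDown h v d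
  h' = h ++ [ (v , suc dₖ) ]

procInterval-frame : ∀ h {j m w d} → j ≤ m → w < j ⊎ m < w →
  laneLen (proj₁ (procInterval h (j , m))) w d ≡ laneLen h w d
procInterval-frame h {j} {m} {w} {d} j≤m outside = begin
  laneLen (proj₁ (procRest h' (suc j) (m ∸ j) d₁)) w d ≡⟨ procRest-frame h' (suc j) (m ∸ j) d₁ (proj₂ outside′) ⟩
  laneLen h' w d                                      ≡⟨ laneLen-∷ʳ-other h (proj₁ outside′ ∘ proj₁) ⟩
  laneLen h w d                                       ∎
  where
  open ≡-Reasoning
  d₁ = maxLane h j
  h' = h ++ [ (j , suc d₁) ]
  outside′ = outside-suc (outside-interval j≤m outside)

-- Stated additively to avoid truncated subtraction.
laneLen-∷ʳ-lane : ∀ h v c d → laneLen (h ++ [ (v , suc c) ]) v (suc d) + 𝟙[ d < c ] ≡ laneLen h v (suc d) + 𝟙[ d < suc c ]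
laneLen-∷ʳ-lane h v c d with d ≟ c
... | yes refl = begin
  laneLen (h ++ [ (v , suc d) ]) v (suc d) + 𝟙[ d < d ] ≡⟨ cong₂ _+_ (laneLen-∷ʳ-self h v (suc d)) (𝟙[<]-0 {d} ≤-refl) ⟩
  suc (laneLen h v (suc d)) + 0                         ≡⟨ trans (+-identityʳ _) (+-comm 1 _) ⟩
  laneLen h v (suc d) + 1                               ≡⟨ cong (laneLen h v (suc d) +_) (sym (𝟙[<]-1 {d} ≤-refl)) ⟩
  laneLen h v (suc d) + 𝟙[ d < suc d ]                  ∎
  where open ≡-Reasoning
... | no d≢c = cong₂ _+_ (laneLen-∷ʳ-other h (d≢c ∘ sym ∘ suc-injective ∘ proj₂)) (sym (𝟙[<]-suc d≢c))

LyndonUpTo : ℕ → List Interval → Set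
LyndonUpTo l ρ = ∀ {i i'} → i < i' → i' ≤ l → headCount i ρ ≤ headCount i' ρ

LanesFromReach : ℕ → List Interval → Hist → Set
LanesFromReach l β h = ∀ w d → w ≤ l → laneLen h w (suc d) ≡ sumBelow (λ j' → 𝟙[ d < reachCount j' w β ]) (suc w)

lanesFromReach-[] : ∀ l → LanesFromReach l [] []
lanesFromReach-[] l w d _ = sym (sumBelow-zero (suc w) (λ _ _ → refl))

lanesFromReach-outside : ∀ {l β h j m} → LanesFromReach l β h → j ≤ m →
  ∀ w d → w ≤ l → w < j ⊎ m < w →
  laneLen (proj₁ (procInterval h (j , m))) w (suc d) ≡ sumBelow (λ j' → 𝟙[ d < reachCount j' w (β ++ [ (j , m) ]) ]) (suc w)
lanesFromReach-outside {l} {β} {h} {j} {m} lanes j≤m w d w≤l outside = begin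
  laneLen (proj₁ (procInterval h (j , m))) w (suc d)                  ≡⟨ procInterval-frame h j≤m outside ⟩
  laneLen h w (suc d)                                                  ≡⟨ lanes w d w≤l ⟩
  sumBelow (λ j' → 𝟙[ d < reachCount j' w β ]) (suc w)                 ≡⟨ sumBelow-cong (suc w) unchanged ⟩
  sumBelow (λ j' → 𝟙[ d < reachCount j' w (β ++ [ (j , m) ]) ]) (suc w) ∎
  where
  open ≡-Reasoning
  missed : ∀ {j'} → j' ≤ w → ¬ (j ≡ j' × w ≤ m)
  missed j'≤w (refl , w≤m) = [ (λ w<j → <⇒≱ w<j j'≤w) , (λ m<w → <⇒≱ m<w w≤m) ]′ outside
  unchanged : ∀ j' → j' < suc w → 𝟙[ d < reachCount j' w β ] ≡ 𝟙[ d < reachCount j' w (β ++ [ (j , m) ]) ]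
  unchanged j' j'<w = cong 𝟙[ d <_] (sym (reachCount-∷ʳ-other β (missed (≤-pred j'<w))))

-- The entries v , v + 1 , … of an interval with head j, once its lane search is at c,
-- as long as the values stay ≤ l.
module SameLaneRun (j c l : ℕ) where

  Ready : ℕ → ℕ → Hist → Set
  Ready v k h = ∀ w → v ≤ w → w < v + k → w ≤ l → laneLen h w (suc c) ≡ w ∸ j × Drops h w c

  ready-∷ʳ : ∀ {v k h} → Ready v (suc k) h → Ready (suc v) k (h ++ [ (v , suc c) ])
  ready-∷ʳ {v} {k} {h} ready w v<w w<v+k w≤l =
    trans (same (suc c)) (proj₁ readyʷ) , drops-resp {h} {h ++ [ (v , suc c) ]} (sym ∘ same) (proj₂ readyʷ)
    where
    same : ∀ d → laneLen (h ++ [ (v , suc c) ]) w d ≡ laneLen h w d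
    same d = laneLen-∷ʳ-other h (<⇒≢ v<w ∘ proj₁)
    readyʷ = ready w (<⇒≤ v<w) (subst (w <_) (sym (+-suc v k)) w<v+k) w≤l

  stops : ∀ {v k h} → Ready v (suc k) h → v ≤ l → searchDown h v c ≡ c
  stops {v} {k} {h} ready v≤l = searchDown-stops h v c (proj₂ (ready v ≤-refl (m<m+n v z<s) v≤l))

  table : ∀ k v h → Ready v k h → ∀ i → i < k → v + i ≤ l →
          nthD (0 , 0) (proj₂ (procRest h v k c)) i ≡ (suc c , suc (v + i ∸ j))
  table (suc k) v h ready zero _ v+0≤l = begin
    nthD (0 , 0) (proj₂ (procRest h v (suc k) c)) 0
      ≡⟨ cong (λ r → nthD (0 , 0) (proj₂ r) 0) (procRest-unfold h v k c (stops ready v≤l)) ⟩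
    (suc c , laneLen (h ++ [ (v , suc c) ]) v (suc c))
      ≡⟨ cong (suc c ,_) (laneLen-∷ʳ-self h v (suc c)) ⟩
    (suc c , suc (laneLen h v (suc c)))
      ≡⟨ cong (λ x → suc c , suc x) (proj₁ (ready v ≤-refl (m<m+n v z<s) v≤l)) ⟩
    (suc c , suc (v ∸ j))
      ≡⟨ cong (λ x → suc c , suc (x ∸ j)) (+-identityʳ v) ⟨
    (suc c , suc (v + 0 ∸ j))
      ∎
    where
    open ≡-Reasoning
    v≤l = subst (_≤ l) (+-identityʳ v) v+0≤l
  table (suc k) v h ready (suc i) (s≤s i<k) v+i≤l = begin
    nthD (0 , 0) (proj₂ (procRest h v (suc k) c)) (suc i)
      ≡⟨ cong (λ r → nthD (0 , 0) (proj₂ r) (suc i)) (procRest-unfold h v k c (stops ready v≤l)) ⟩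
    nthD (0 , 0) (proj₂ (procRest h' (suc v) k c)) i
      ≡⟨ table k (suc v) h' (ready-∷ʳ {v} {k} {h} ready) i i<k (subst (_≤ l) (+-suc v i) v+i≤l) ⟩
    (suc c , suc (suc v + i ∸ j))
      ≡⟨ cong (λ x → suc c , suc (x ∸ j)) (+-suc v i) ⟨
    (suc c , suc (v + suc i ∸ j))
      ∎
    where
    open ≡-Reasoning
    h' = h ++ [ (v , suc c) ]
    v≤l = ≤-trans (m≤m+n v (suc i)) v+i≤l

  lanes : ∀ k v h → Ready v k h → ∀ w d → v ≤ w → w < v + k → w ≤ l →
          laneLen (proj₁ (procRest h v k c)) w d ≡ laneLen (h ++ [ (w , suc c) ]) w d
  lanes zero v h _ w d v≤w w<v+0 _ = contradiction (subst (_≤ w) (sym (+-identityʳ v)) v≤w) (<⇒≱ w<v+0)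
  lanes (suc k) v h ready w d v≤w w<v+k w≤l with v ≟ w
  ... | yes refl = begin
    laneLen (proj₁ (procRest h v (suc k) c)) v d
      ≡⟨ cong (λ r → laneLen (proj₁ r) v d) (procRest-unfold h v k c (stops ready w≤l)) ⟩
    laneLen (proj₁ (procRest h' (suc v) k c)) v d
      ≡⟨ procRest-frame h' (suc v) k c (inj₁ ≤-refl) ⟩
    laneLen h' v d
      ∎
    where
    open ≡-Reasoning
    h' = h ++ [ (v , suc c) ]
  ... | no v≢w = begin
    laneLen (proj₁ (procRest h v (suc k) c)) w d
      ≡⟨ cong (λ r → laneLen (proj₁ r) w d) (procRest-unfold h v k c (stops ready (≤-trans v≤w w≤l))) ⟩
    laneLen (proj₁ (procRest h' (suc v) k c)) w d
      ≡⟨ lanes k (suc v) h' (ready-∷ʳ {v} {k} {h} ready) w d (≤∧≢⇒< v≤w v≢w) (subst (w <_) (+-suc v k) w<v+k) w≤l ⟩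
    laneLen (h' ++ [ (w , suc c) ]) w d
      ≡⟨ laneLen-skip h [ (w , suc c) ] v≢w ⟩
    laneLen (h ++ [ (w , suc c) ]) w d
      ∎
    where
    open ≡-Reasoning
    h' = h ++ [ (v , suc c) ]

module Step {l : ℕ} {β : List Interval} {h : Hist} {j m : ℕ}
            (lanes : LanesFromReach l β h) (j≤m : j ≤ m) (j≤l : j ≤ l)
            (reachM : All (λ I → m ≤ proj₂ I) β)
            (lyndon : LyndonUpTo l β) (lyndon′ : LyndonUpTo l (β ++ [ (j , m) ])) where

  c : ℕ
  c = headCount j β

  reachCount≤c : ∀ {j' w} → j' ≤ j → reachCount j' w β ≤ c
  reachCount≤c {j'} {w} j'≤j with j' ≟ j
  ... | yes refl = reachCount≤headCount j w β
  ... | no j'≢j  = ≤-trans (reachCount≤headCount j' w β) (lyndon (≤∧≢⇒< j'≤j j'≢j) j≤l)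

  reachCount≡c : ∀ {w} → w ≤ m → reachCount j w β ≡ c
  reachCount≡c {w} w≤m = reachCount≡headCount j w β (All.map (≤-trans w≤m) reachM)

  c<reachCount : ∀ {j' w} → j < j' → j' ≤ l → w ≤ m → c < reachCount j' w β
  c<reachCount {j'} {w} j<j' j'≤l w≤m = begin-strict
    c                               <⟨ n<1+n c ⟩
    suc c                           ≡⟨ headCount-∷ʳ-self j m β ⟨
    headCount j (β ++ [ (j , m) ])  ≤⟨ lyndon′ j<j' j'≤l ⟩
    headCount j' (β ++ [ (j , m) ]) ≡⟨ headCount-∷ʳ-other m β (<⇒≢ j<j') ⟩
    headCount j' β                  ≡⟨ reachCount≡headCount j' w β (All.map (≤-trans w≤m) reachM) ⟨
    reachCount j' w β               ∎
    where open ≤-Reasoning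

  c≤reachCount : ∀ {j' w} → j ≤ j' → j' ≤ l → w ≤ m → c ≤ reachCount j' w β
  c≤reachCount {j'} j≤j' j'≤l w≤m with j ≟ j'
  ... | yes refl = ≤-reflexive (sym (reachCount≡c w≤m))
  ... | no j≢j'  = <⇒≤ (c<reachCount (≤∧≢⇒< j≤j' j≢j') j'≤l w≤m)

  headLanesAbove-empty : ∀ {d} → c ≤ d → laneLen h j (suc d) ≡ 0
  headLanesAbove-empty {d} c≤d = trans (lanes j d j≤l)
    (sumBelow-zero (suc j) (λ j' j'<j → 𝟙[<]-0 (≤-trans (reachCount≤c (≤-pred j'<j)) c≤d)))

  laneLen-c+1 : ∀ {w} → w ≤ m → w ≤ l → laneLen h w (suc c) ≡ w ∸ j
  laneLen-c+1 {w} w≤m w≤l = trans (lanes w c w≤l) (sumBelow-step j (suc w)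
    (λ j' _ j'≤j → 𝟙[<]-0 (reachCount≤c j'≤j))
    (λ j' j'<w j<j' → 𝟙[<]-1 (c<reachCount j<j' (≤-trans (≤-pred j'<w) w≤l) w≤m)))

  drops : ∀ {w} → j ≤ w → w ≤ m → w ≤ l → Drops h w c
  drops {w} j≤w w≤m w≤l with c in c≡
  ... | zero    = inj₁ refl
  ... | suc c′ = inj₂ (begin-strict
    laneLen h w (suc (suc c′))                                ≡⟨ cong (λ x → laneLen h w (suc x)) c≡ ⟨
    laneLen h w (suc c)                                       ≡⟨ laneLen-c+1 w≤m w≤l ⟩
    w ∸ j                                                     <⟨ n<1+n (w ∸ j) ⟩
    suc (w ∸ j)                                               ≡⟨ +-∸-assoc 1 j≤w ⟨
    suc w ∸ j                                                 ≤⟨ sumBelow-lower j (suc w) ones ⟩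
    sumBelow (λ j' → 𝟙[ c′ < reachCount j' w β ]) (suc w)     ≡⟨ lanes w c′ w≤l ⟨
    laneLen h w (suc c′)                                      ∎)
    where
    open ≤-Reasoning
    ones : ∀ j' → j ≤ j' → j' < suc w → 𝟙[ c′ < reachCount j' w β ] ≡ 1
    ones j' j≤j' j'<w = 𝟙[<]-1 (subst (_≤ reachCount j' w β) c≡ (c≤reachCount j≤j' (≤-trans (≤-pred j'<w) w≤l) w≤m))

  maxLane≡c : maxLane h j ≡ c
  maxLane≡c = ≤-antisym (maxLane-≤ h j c above) (below (drops ≤-refl j≤m j≤l))
    where
    above : ∀ d → c < d → laneLen h j d ≡ 0
    above (suc d) (s≤s c≤d) = headLanesAbove-empty c≤d
    below : Drops h j c → c ≤ maxLane h j
    below (inj₁ c≡0)    = ≤-trans (≤-reflexive c≡0) z≤n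
    below (inj₂ longer) = ≤-maxLane h j c (≤-trans (s≤s z≤n) longer)

  private
    h' : Hist
    h' = h ++ [ (j , suc c) ]

    unfold = procInterval-unfold h j m maxLane≡c

    tailEnd : suc j + (m ∸ j) ≡ suc m
    tailEnd = cong suc (m+[n∸m]≡n j≤m)

  open SameLaneRun j c l using (Ready)

  ready : Ready (suc j) (m ∸ j) h'
  ready w j<w w<end w≤l =
    trans (same (suc c)) (laneLen-c+1 w≤m w≤l) , drops-resp {h} {h'} (sym ∘ same) (drops (<⇒≤ j<w) w≤m w≤l)
    where
    w≤m : w ≤ m
    w≤m = ≤-pred (subst (w <_) tailEnd w<end)
    same : ∀ d → laneLen h' w d ≡ laneLen h w d
    same d = laneLen-∷ʳ-other h (<⇒≢ j<w ∘ proj₁)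

  row : ∀ i → j + i ≤ m → j + i ≤ l → nthD (0 , 0) (proj₂ (procInterval h (j , m))) i ≡ (suc c , suc i)
  row zero _ _ = begin
    nthD (0 , 0) (proj₂ (procInterval h (j , m))) 0 ≡⟨ cong (λ r → nthD (0 , 0) (proj₂ r) 0) unfold ⟩
    (suc c , laneLen h' j (suc c))                 ≡⟨ cong (suc c ,_) (laneLen-∷ʳ-self h j (suc c)) ⟩
    (suc c , suc (laneLen h j (suc c)))            ≡⟨ cong (λ x → suc c , suc x) (headLanesAbove-empty ≤-refl) ⟩
    (suc c , 1)                                    ∎
    where open ≡-Reasoning
  row (suc i) j+i<m j+i<l = begin
    nthD (0 , 0) (proj₂ (procInterval h (j , m))) (suc i)
      ≡⟨ cong (λ r → nthD (0 , 0) (proj₂ r) (suc i)) unfold ⟩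
    nthD (0 , 0) (proj₂ (procRest h' (suc j) (m ∸ j) c)) i
      ≡⟨ SameLaneRun.table j c l (m ∸ j) (suc j) h' ready i i<m∸j (subst (_≤ l) (+-suc j i) j+i<l) ⟩
    (suc c , suc (suc j + i ∸ j))
      ≡⟨ cong (λ x → suc c , suc (x ∸ j)) (+-suc j i) ⟨
    (suc c , suc (j + suc i ∸ j))
      ≡⟨ cong (λ x → suc c , suc x) (m+n∸m≡n j (suc i)) ⟩
    (suc c , suc (suc i))
      ∎
    where
    open ≡-Reasoning
    i<m∸j : i < m ∸ j
    i<m∸j = subst (_≤ m ∸ j) (m+n∸m≡n j (suc i)) (∸-monoˡ-≤ j j+i<m)

  lanes-inside : ∀ {w} d → j ≤ w → w ≤ m → w ≤ l →
    laneLen (proj₁ (procInterval h (j , m))) w d ≡ laneLen (h ++ [ (w , suc c) ]) w d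
  lanes-inside {w} d j≤w w≤m w≤l with j ≟ w
  ... | yes refl = begin
    laneLen (proj₁ (procInterval h (j , m))) j d         ≡⟨ cong (λ r → laneLen (proj₁ r) j d) unfold ⟩
    laneLen (proj₁ (procRest h' (suc j) (m ∸ j) c)) j d  ≡⟨ procRest-frame h' (suc j) (m ∸ j) c (inj₁ ≤-refl) ⟩
    laneLen h' j d                                       ∎
    where open ≡-Reasoning
  ... | no j≢w = begin
    laneLen (proj₁ (procInterval h (j , m))) w d
      ≡⟨ cong (λ r → laneLen (proj₁ r) w d) unfold ⟩
    laneLen (proj₁ (procRest h' (suc j) (m ∸ j) c)) w d
      ≡⟨ SameLaneRun.lanes j c l (m ∸ j) (suc j) h' ready w d (≤∧≢⇒< j≤w j≢w) (subst (w <_) (sym tailEnd) (s≤s w≤m)) w≤l ⟩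
    laneLen (h' ++ [ (w , suc c) ]) w d
      ≡⟨ laneLen-skip h [ (w , suc c) ] j≢w ⟩
    laneLen (h ++ [ (w , suc c) ]) w d
      ∎
    where open ≡-Reasoning

  lanesFromReach-inside : ∀ w d → j ≤ w → w ≤ m → w ≤ l →
    laneLen (proj₁ (procInterval h (j , m))) w (suc d) ≡ sumBelow (λ j' → 𝟙[ d < reachCount j' w (β ++ [ (j , m) ]) ]) (suc w)
  lanesFromReach-inside w d j≤w w≤m w≤l = +-cancelʳ-≡ 𝟙[ d < c ] _ _ (begin
    laneLen (proj₁ (procInterval h (j , m))) w (suc d) + 𝟙[ d < c ]
      ≡⟨ cong (_+ 𝟙[ d < c ]) (lanes-inside (suc d) j≤w w≤m w≤l) ⟩
    laneLen (h ++ [ (w , suc c) ]) w (suc d) + 𝟙[ d < c ]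
      ≡⟨ laneLen-∷ʳ-lane h w c d ⟩
    laneLen h w (suc d) + 𝟙[ d < suc c ]
      ≡⟨ cong₂ _+_ (lanes w d w≤l) (sym gⱼ) ⟩
    sumBelow f (suc w) + g j
      ≡⟨ sumBelow-update j (suc w) agree (s≤s j≤w) ⟨
    sumBelow g (suc w) + f j
      ≡⟨ cong (sumBelow g (suc w) +_) fⱼ ⟩
    sumBelow g (suc w) + 𝟙[ d < c ]
      ∎)
    where
    open ≡-Reasoning
    f g : ℕ → ℕ
    f j' = 𝟙[ d < reachCount j' w β ]
    g j' = 𝟙[ d < reachCount j' w (β ++ [ (j , m) ]) ]
    fⱼ : f j ≡ 𝟙[ d < c ]
    fⱼ = cong 𝟙[ d <_] (reachCount≡c w≤m)
    gⱼ : g j ≡ 𝟙[ d < suc c ]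
    gⱼ = cong 𝟙[ d <_] (trans (reachCount-∷ʳ-self j w β w≤m) (cong suc (reachCount≡c w≤m)))
    agree : ∀ j' → j' < suc w → ¬ j' ≡ j → f j' ≡ g j'
    agree j' _ j'≢j = cong 𝟙[ d <_] (sym (reachCount-∷ʳ-other β (j'≢j ∘ sym ∘ proj₁)))

  lanesFromReach-∷ʳ : LanesFromReach l (β ++ [ (j , m) ]) (proj₁ (procInterval h (j , m)))
  lanesFromReach-∷ʳ w d w≤l with w <? j | m <? w
  ... | yes w<j | _       = lanesFromReach-outside {β = β} lanes j≤m w d w≤l (inj₁ w<j)
  ... | no _    | yes m<w = lanesFromReach-outside {β = β} lanes j≤m w d w≤l (inj₂ m<w)
  ... | no w≮j  | no m≮w  = lanesFromReach-inside w d (≮⇒≥ w≮j) (≮⇒≥ m≮w) w≤l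

EndsNoEarlier : Interval → Interval → Set
EndsNoEarlier I I' = proj₂ I' ≤ proj₂ I

precedes⇒endsNoEarlier : ∀ {I I'} → Precedes I I' → EndsNoEarlier I I'
precedes⇒endsNoEarlier (inj₁ m'<m)      = <⇒≤ m'<m
precedes⇒endsNoEarlier (inj₂ (m'≡m , _)) = ≤-reflexive m'≡m

lowerSubinterval-head≤end : ∀ {n} I → IsLowerSubinterval n I → proj₁ I ≤ proj₂ I
lowerSubinterval-head≤end (a , m) (_ , a≤m , _) = a≤m

rows : ∀ l β h γ → LanesFromReach l β h →
  All (λ I → proj₁ I ≤ proj₂ I) γ → AllPairs EndsNoEarlier γ → All (λ I → All (EndsNoEarlier I) γ) β →
  (∀ i → LyndonUpTo l (β ++ take i γ)) →
  (b : Fin (length γ)) → proj₁ (lookup γ b) ≤ l →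
  ∃[ L ] ∀ i → proj₁ (lookup γ b) + i ≤ proj₂ (lookup γ b) → proj₁ (lookup γ b) + i ≤ l →
    nthD (0 , 0) (nthD [] (laneTableFrom h γ) (toℕ b)) i ≡ (L , suc i)
rows l β h ((j , m) ∷ γ) lanes (j≤m ∷ _) _ before lyndon fzero j≤l =
  suc (headCount j β) , Step.row lanes j≤m j≤l (All.map All.head before) lyndonβ (lyndon 1)
  where
  lyndonβ = subst (LyndonUpTo l) (++-identityʳ β) (lyndon 0)
rows l β h ((j , m) ∷ γ) lanes (j≤m ∷ ordered) (first ∷ pairs) before lyndon (fsuc b) head≤l =
  rows l (β ++ [ (j , m) ]) (proj₁ (procInterval h (j , m))) γ lanes′ ordered pairs before′ lyndon′ b head≤l
  where
  lanes′ : LanesFromReach l (β ++ [ (j , m) ]) (proj₁ (procInterval h (j , m)))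
  lanes′ with j ≤? l
  ... | yes j≤l = Step.lanesFromReach-∷ʳ lanes j≤m j≤l (All.map All.head before) lyndonβ (lyndon 1)
    where lyndonβ = subst (LyndonUpTo l) (++-identityʳ β) (lyndon 0)
  ... | no j≰l  = λ w d w≤l → lanesFromReach-outside {β = β} lanes j≤m w d w≤l (inj₁ (≤-<-trans w≤l (≰⇒> j≰l)))
  before′ : All (λ I → All (EndsNoEarlier I) γ) (β ++ [ (j , m) ])
  before′ = ++⁺ (All.map All.tail before) (first ∷ [])
  lyndon′ : ∀ i → LyndonUpTo l ((β ++ [ (j , m) ]) ++ take i γ)
  lyndon′ i = subst (LyndonUpTo l) (sym (++-assoc β [ (j , m) ] (take i γ))) (lyndon (suc i))

mainTheorem13 : (n : ℕ) (α : List Interval) → IsCascading n α →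
    (l : ℕ) → 1 ≤ l → l ≤ n →
    (∀ l' → 1 ≤ l' → l' ≤ l → LyndonFor α l') →
    (b : Fin (length α)) → proj₁ (lookup α b) ≤ l →
    ((v w : ℕ) → proj₁ (lookup α b) ≤ v → v ≤ proj₂ (lookup α b) → v ≤ l →
       proj₁ (lookup α b) ≤ w → w ≤ proj₂ (lookup α b) → w ≤ l →
       laneNumber α b v ≡ laneNumber α b w)
    ×
    ((v : ℕ) → proj₁ (lookup α b) ≤ v → v ≤ proj₂ (lookup α b) → v ≤ l →
       laneDepth α b v ≡ suc (v ∸ proj₁ (lookup α b)))
mainTheorem13 n α (lower , cascading) l _ _ lyndon b a≤l = sameLane , depth
  where
  a = proj₁ (lookup α b)
  m = proj₂ (lookup α b)
  row = rows l [] [] α (lanesFromReach-[] l) (All.map (lowerSubinterval-head≤end _) lower)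
          (Linked⇒AllPairs (λ p q → ≤-trans q p) (Linked.map precedes⇒endsNoEarlier cascading)) []
          (λ i {j'} j'<l' l'≤l → lyndon _ (≤-trans (s≤s z≤n) j'<l') l'≤l i j' j'<l') b a≤l
  entry : ∀ v → a ≤ v → v ≤ m → v ≤ l → entryInfo α b v ≡ (proj₁ row , suc (v ∸ a))
  entry v a≤v v≤m v≤l = proj₂ row (v ∸ a) (subst (_≤ m) v≡a+[v∸a] v≤m) (subst (_≤ l) v≡a+[v∸a] v≤l)
    where v≡a+[v∸a] = sym (m+[n∸m]≡n a≤v)
  sameLane : ∀ v w → a ≤ v → v ≤ m → v ≤ l → a ≤ w → w ≤ m → w ≤ l → laneNumber α b v ≡ laneNumber α b w
  sameLane v w a≤v v≤m v≤l a≤w w≤m w≤l =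
    trans (cong proj₁ (entry v a≤v v≤m v≤l)) (sym (cong proj₁ (entry w a≤w w≤m w≤l)))
  depth : ∀ v → a ≤ v → v ≤ m → v ≤ l → laneDepth α b v ≡ suc (v ∸ a)
  depth v a≤v v≤m v≤l = cong proj₂ (entry v a≤v v≤m v≤l)
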